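{- Every $c$-epichristoffel word of length greater than $1$ can be written as a product $uv$ of two $c$-epichristoffel words $u,v$; moreover such a factorization is in general not unique.
   Context: For letters $a,b$ of a finite alphabet $\mathcal{A}$: $\psi_a(a)=\overline{\psi}_a(a)=a$, $\psi_a(x)=ax$, $\overline{\psi}_a(x)=xa$ for letters $x\neq a$, and $\theta_{ab}$ swaps $a,b$ and fixes other letters; episturmian morphisms are compositions of these. A finite word is $c$-epichristoffel if it is the image of a letter under an episturmian morphism. -}

module Defs where

open import Data.Nat using (ℕ)
open import Data.Fin using (Fin; _≟_)
open import Data.List using (List; []; _∷_; [_]; concatMap)
open import Data.Product using (∃; ∃-syntax; _×_)
open import Relation.Nullary using (yes; no)
open import Relation.Binary.PropositionalEquality using (_≡_)

Word : ℕ → Set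
Word n = List (Fin n)

data Gen (n : ℕ) : Set where
  psi    : Fin n → Gen n
  psibar : Fin n → Gen n
  theta  : Fin n → Fin n → Gen n

genLetter : ∀ {n} → Gen n → Fin n → Word n
genLetter (psi a) x with x ≟ a
... | yes _ = a ∷ []
... | no  _ = a ∷ x ∷ []
genLetter (psibar a) x with x ≟ a
... | yes _ = a ∷ []
... | no  _ = x ∷ a ∷ []
genLetter (theta a b) x with x ≟ a | x ≟ b
... | yes _ | _     = b ∷ []
... | no  _ | yes _ = a ∷ []
... | no  _ | no  _ = x ∷ []

applyGen : ∀ {n} → Gen n → Word n → Word n
applyGen g = concatMap (genLetter g)

-- An episturmian morphism is a (possibly empty) composition of generators;
-- the list g₁ ∷ g₂ ∷ … ∷ gₖ ∷ [] denotes g₁ ∘ g₂ ∘ … ∘ gₖ.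
Episturmian : ℕ → Set
Episturmian n = List (Gen n)

applyMorph : ∀ {n} → Episturmian n → Word n → Word n
applyMorph []      w = w
applyMorph (g ∷ f) w = applyGen g (applyMorph f w)

CEpichristoffel : ∀ {n} → Word n → Set
CEpichristoffel {n} w = ∃[ f ] ∃[ a ] (applyMorph {n} f [ a ] ≡ w)

module Submission where

-- Every elementary morphism ψ_a, ψ̄_a, θ_ab sends a letter to a
-- word of length one or two, and every letter is c-epichristoffel.  Hence,
-- writing an episturmian morphism as g ∘ f, induction on its length shows
-- that the image of a letter x is either a single letter, or splits as a
-- product uv of two c-epichristoffel words:
--   * if f(x) = uv already splits, then g(f(x)) = g(u) g(v) splits, since
--     each generator is a monoid morphism and c-epichristoffel words are
--     closed under generators;
--   * if f(x) = b is a letter, then g(b) is either a letter or a two-letter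
--     word cd, which splits as the two letters c and d.
-- A c-epichristoffel word of length > 1 is not a letter, so it splits.
-- Non-uniqueness: aba = ψ_a ψ_b (a) factorises both as (ab)(a) and (a)(ba),
-- where ab = ψ_a(b), ba = ψ_b(a).

open import Defs
open import Data.Nat using (ℕ; _<_; s≤s)
open import Data.Fin using (Fin; zero; suc; _≟_)
open import Data.List using ([]; _∷_; [_]; length; _++_)
open import Data.List.Properties using (concatMap-++; ++-identityʳ)
open import Data.Product using (∃-syntax; _×_; _,_)
open import Data.Sum using (_⊎_; inj₁; inj₂)
open import Relation.Nullary using (yes; no)
open import Relation.Binary.PropositionalEquality
  using (_≡_; _≢_; refl; trans; cong; module ≡-Reasoning)

ShortWord : ∀ {n} → Word n → Set
ShortWord {n} w = (∃[ c ] (w ≡ [ c ])) ⊎ (∃[ c ] ∃[ d ] (w ≡ c ∷ d ∷ []))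

genLetter-short : ∀ {n} (g : Gen n) (x : Fin n) → ShortWord (genLetter g x)
genLetter-short (psi a) x with x ≟ a
... | yes _ = inj₁ (a , refl)
... | no  _ = inj₂ (a , x , refl)
genLetter-short (psibar a) x with x ≟ a
... | yes _ = inj₁ (a , refl)
... | no  _ = inj₂ (x , a , refl)
genLetter-short (theta a b) x with x ≟ a | x ≟ b
... | yes _ | _     = inj₁ (b , refl)
... | no  _ | yes _ = inj₁ (a , refl)
... | no  _ | no  _ = inj₁ (x , refl)

applyGen-letter : ∀ {n} (g : Gen n) {w : Word n} {x : Fin n} →
                  w ≡ [ x ] → applyGen g w ≡ genLetter g x
applyGen-letter g {x = x} refl = ++-identityʳ (genLetter g x)

letter-ce : ∀ {n} (c : Fin n) → CEpichristoffel [ c ]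
letter-ce c = [] , c , refl

applyGen-ce : ∀ {n} (g : Gen n) {w : Word n} →
              CEpichristoffel w → CEpichristoffel (applyGen g w)
applyGen-ce g (f , a , refl) = g ∷ f , a , refl

Splits : ∀ {n} → Word n → Set
Splits w = ∃[ u ] ∃[ v ] (CEpichristoffel u × CEpichristoffel v × w ≡ u ++ v)

applyGen-splits : ∀ {n} (g : Gen n) {w : Word n} → Splits w → Splits (applyGen g w)
applyGen-splits g {w} (u , v , ce-u , ce-v , w≡uv) =
  applyGen g u , applyGen g v , applyGen-ce g ce-u , applyGen-ce g ce-v , image
  where
  open ≡-Reasoning
  image : applyGen g w ≡ applyGen g u ++ applyGen g v
  image = begin
    applyGen g w                 ≡⟨ cong (applyGen g) w≡uv ⟩
    applyGen g (u ++ v)          ≡⟨ concatMap-++ (genLetter g) u v ⟩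
    applyGen g u ++ applyGen g v ∎

pair-splits : ∀ {n} (c d : Fin n) → Splits (c ∷ d ∷ [])
pair-splits c d = [ c ] , [ d ] , letter-ce c , letter-ce d , refl

letter-image : ∀ {n} (f : Episturmian n) (a : Fin n) →
               (∃[ b ] (applyMorph f [ a ] ≡ [ b ])) ⊎ Splits (applyMorph f [ a ])
letter-image []      a = inj₁ (a , refl)
letter-image (g ∷ f) a with letter-image f a
... | inj₂ fa-splits = inj₂ (applyGen-splits g fa-splits)
... | inj₁ (b , fa≡b) with genLetter-short g b
...   | inj₁ (c , gb≡c) =
  inj₁ (c , trans (applyGen-letter g fa≡b) gb≡c)
...   | inj₂ (c , d , gb≡cd) rewrite trans (applyGen-letter g fa≡b) gb≡cd =
  inj₂ (pair-splits c d)

ce-splits : (n : ℕ) (w : Word n) → CEpichristoffel w → 1 < length w → Splits w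
ce-splits n w (f , a , refl) long with letter-image f a
... | inj₂ fa-splits = fa-splits
... | inj₁ (b , fa≡b) rewrite fa≡b with long
... | s≤s ()

lemma4p16 : ((n : ℕ) (w : Word n) → CEpichristoffel w → 1 < length w →
    ∃[ u ] ∃[ v ] (CEpichristoffel u × CEpichristoffel v × w ≡ u ++ v))
    × (∃[ n ] ∃[ w ] ∃[ u₁ ] ∃[ v₁ ] ∃[ u₂ ] ∃[ v₂ ]
    (CEpichristoffel {n} w
    × CEpichristoffel u₁ × CEpichristoffel v₁ × w ≡ u₁ ++ v₁
    × CEpichristoffel u₂ × CEpichristoffel v₂ × w ≡ u₂ ++ v₂
    × u₁ ≢ u₂))
lemma4p16 = ce-splits ,
  (2 , a ∷ b ∷ a ∷ [] , a ∷ b ∷ [] , [ a ] , [ a ] , b ∷ a ∷ [] ,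
   (psi a ∷ psi b ∷ [] , a , refl) ,
   (psi a ∷ [] , b , refl) , letter-ce a , refl ,
   letter-ce a , (psi b ∷ [] , a , refl) , refl ,
   λ ())
  where
  a b : Fin 2
  a = zero
  b = suc zero
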